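{- Let $0<t\le1$ be rational and let $G$ be a bridgeless graph that has a $t$-flow-pair. Then $G$ admits a $(2+t,2)$-ChNZF and a $(4+2t,1)$-NZF.
   Context: For a positive integer $k$, a $k$-flow on a graph $G=(V,E)$ is an orientation of the edges together with an integer-valued map $\varphi\colon E\to\mathbb{Z}$ with $|\varphi(e)|\le k-1$ for all edges (zero values allowed) satisfying flow conservation at every vertex (sum of values on incoming edges equals sum on outgoing edges). For a rational $0<t\le1$, a $t$-flow-pair of $G$ is a pair consisting of a $2$-flow $\varphi_2$ and a $(p+q+1)$-flow $\varphi_{p+q+1}$ with the same orientation, for some positive integers $p,q$ with $t=p/q$, such that for every edge $e$, if $\varphi_2(e)=0$ then $|\varphi_{p+q+1}(e)|\ge q$. For an integer $d\ge1$ and real $r\ge2$, an $\mathbb{R}^d$-flow is an orientation with a map $\varphi\colon E\to\mathbb{R}^d$ satisfying flow conservation; an $(r,2)$-ChNZF is an $\mathbb{R}^2$-flow with $1\le\|\varphi(e)\|_\infty\le r-1$ for all edges ($\|(x,y)\|_\infty=\max(|x|,|y|)$); an $(r,1)$-NZF is an $\mathbb{R}$-flow with $1\le|\varphi(e)|\le r-1$ for all edges. -}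

module Defs where

open import Data.Nat as ℕ using (ℕ; zero; suc; _∸_)
open import Data.Integer as ℤ using (ℤ; +_)
open import Data.Rational as ℚ using (ℚ; 0ℚ; 1ℚ)
open import Data.Fin using (Fin; zero; suc; _≟_)
open import Data.Bool using (Bool; true; false; if_then_else_)
open import Data.Product using (_×_; _,_; proj₁; proj₂; Σ; ∃; ∃-syntax)
open import Relation.Nullary using (¬_)
open import Relation.Nullary.Decidable using (⌊_⌋)
open import Relation.Binary.PropositionalEquality using (_≡_)

-- A finite (multi)graph: vertices Fin n, edges Fin m, each edge has an
-- unordered pair of ends (listed in some reference order). Loops and
-- parallel edges are allowed.
record Graph : Set where
  field
    nV   : ℕ
    nE   : ℕ
    ends : Fin nE → Fin nV × Fin nV
open Graph public

-- An orientation: for each edge, whether it is oriented from the first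
-- listed end to the second (false) or reversed (true).
Orientation : Graph → Set
Orientation G = Fin (nE G) → Bool

tailOf headOf : (G : Graph) → Orientation G → Fin (nE G) → Fin (nV G)
tailOf G o e = if o e then proj₂ (ends G e) else proj₁ (ends G e)
headOf G o e = if o e then proj₁ (ends G e) else proj₂ (ends G e)

sumFin : {A : Set} → (A → A → A) → A → (m : ℕ) → (Fin m → A) → A
sumFin _+_ z zero    f = z
sumFin _+_ z (suc m) f = f zero + sumFin _+_ z m (λ i → f (suc i))

Conserves : {A : Set} → (A → A → A) → A → (G : Graph) → Orientation G →
            (Fin (nE G) → A) → Set
Conserves _+_ z G o φ = ∀ (v : Fin (nV G)) →
  sumFin _+_ z (nE G) (λ e → if ⌊ headOf G o e ≟ v ⌋ then φ e else z)
  ≡ sumFin _+_ z (nE G) (λ e → if ⌊ tailOf G o e ≟ v ⌋ then φ e else z)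

data ConnWithout (G : Graph) (d : Fin (nE G)) : Fin (nV G) → Fin (nV G) → Set where
  here : ∀ {u} → ConnWithout G d u u
  stepF : ∀ {u w} (f : Fin (nE G)) → ¬ (f ≡ d) → proj₁ (ends G f) ≡ u →
          ConnWithout G d (proj₂ (ends G f)) w → ConnWithout G d u w
  stepB : ∀ {u w} (f : Fin (nE G)) → ¬ (f ≡ d) → proj₂ (ends G f) ≡ u →
          ConnWithout G d (proj₁ (ends G f)) w → ConnWithout G d u w

IsBridge : (G : Graph) → Fin (nE G) → Set
IsBridge G e = ¬ ConnWithout G e (proj₁ (ends G e)) (proj₂ (ends G e))

Bridgeless : Graph → Set
Bridgeless G = ∀ e → ¬ IsBridge G e

-- k-flow (integer values, |φ e| ≤ k-1, zero allowed) w.r.t. orientation o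
IsKFlow : (k : ℕ) (G : Graph) → Orientation G → (Fin (nE G) → ℤ) → Set
IsKFlow k G o φ = Conserves ℤ._+_ (+ 0) G o φ × (∀ e → ℤ.∣ φ e ∣ ℕ.≤ k ∸ 1)

HasFlowPair : ℚ → Graph → Set
HasFlowPair t G =
  Σ ℕ λ p → Σ ℕ λ q → Σ (ℕ.NonZero q) λ nz →
    ℕ.NonZero p × (t ≡ ((+ p) ℚ./ q) {{nz}}) ×
    Σ (Orientation G) λ o → Σ (Fin (nE G) → ℤ) λ φ₂ → Σ (Fin (nE G) → ℤ) λ φ →
      IsKFlow 2 G o φ₂ × IsKFlow (p ℕ.+ q ℕ.+ 1) G o φ ×
      (∀ e → φ₂ e ≡ + 0 → q ℕ.≤ ℤ.∣ φ e ∣)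

-- ℝ^d-flows are taken with rational values.
_+²_ : ℚ × ℚ → ℚ × ℚ → ℚ × ℚ
(a , b) +² (c , d) = (a ℚ.+ c , b ℚ.+ d)

normInf : ℚ × ℚ → ℚ
normInf (x , y) = ℚ.∣ x ∣ ℚ.⊔ ℚ.∣ y ∣

HasChNZF2 : ℚ → Graph → Set
HasChNZF2 r G = Σ (Orientation G) λ o → Σ (Fin (nE G) → ℚ × ℚ) λ φ →
  Conserves _+²_ (0ℚ , 0ℚ) G o φ ×
  (∀ e → (1ℚ ℚ.≤ normInf (φ e)) × (normInf (φ e) ℚ.≤ r ℚ.- 1ℚ))

HasNZF1 : ℚ → Graph → Set
HasNZF1 r G = Σ (Orientation G) λ o → Σ (Fin (nE G) → ℚ) λ φ →
  Conserves ℚ._+_ 0ℚ G o φ ×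
  (∀ e → (1ℚ ℚ.≤ ℚ.∣ φ e ∣) × (ℚ.∣ φ e ∣ ℚ.≤ r ℚ.- 1ℚ))

-- Write t = p/q, φ₂ for the 2-flow and φ for the (p+q+1)-flow of the flow pair.
-- The pair (φ₂, φ/q) is an ℚ²-flow with sup-norm in [1, 1+t]: where φ₂ vanishes,
-- |φ| ≥ q.  The merged flow ((2q+p)·φ₂ + φ)/q is an ℚ-flow with absolute value in
-- [1, 3+2t]: where φ₂ = ±1, the term (2q+p)·φ₂ outweighs |φ| ≤ p+q by at least q.
-- Both constructions are additive in (φ₂, φ), so they preserve flow conservation.

module Submission where

open import Defs
open import Data.Rational using (ℚ; 0ℚ; 1ℚ; _<_; _≤_; _+_; _*_)
open import Data.Product using (_×_)
open import Data.Product using (_,_; proj₁; proj₂; map₂)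

open import Data.Bool using (Bool; true; false; if_then_else_)
open import Data.Fin as Fin using (Fin)
open import Data.Integer as ℤ using (ℤ; +_; -[1+_])
import Data.Integer.Properties as ℤP
open import Data.Integer.Solver using (module +-*-Solver)
open import Data.Nat as ℕ using (ℕ; suc; _∸_; NonZero)
import Data.Nat.Properties as ℕP
open import Data.Rational as ℚ using (_/_; ∣_∣; toℚᵘ)
import Data.Rational.Properties as ℚP
import Data.Rational.Solver as ℚSolver
import Data.Rational.Unnormalised as ℚᵘ
import Data.Rational.Unnormalised.Properties as ℚᵘP
open import Data.Sum using (_⊎_; inj₁; inj₂)
open import Relation.Binary.PropositionalEquality

toℚᵘ-/ : ∀ i n .{{_ : NonZero n}} → toℚᵘ (i / n) ℚᵘ.≃ (i ℚᵘ./ n)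
toℚᵘ-/ i n@(suc _) = ℚP.toℚᵘ-fromℚᵘ (i ℚᵘ./ n)

/-distribʳ-+ : ∀ i j n .{{_ : NonZero n}} → (i ℤ.+ j) / n ≡ i / n + j / n
/-distribʳ-+ i j n@(suc _) = ℚP.toℚᵘ-injective (begin
  toℚᵘ ((i ℤ.+ j) / n)                     ≈⟨ toℚᵘ-/ (i ℤ.+ j) n ⟩
  (i ℤ.+ j) ℚᵘ./ n                         ≈⟨ ℚᵘ.*≡* (solve 3 (λ x y d → (x :+ y) :* (d :* d) := (x :* d :+ y :* d) :* d) refl i j (+ n)) ⟩
  (i ℚᵘ./ n) ℚᵘ.+ (j ℚᵘ./ n)               ≈⟨ ℚᵘP.+-cong (toℚᵘ-/ i n) (toℚᵘ-/ j n) ⟨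
  toℚᵘ (i / n) ℚᵘ.+ toℚᵘ (j / n)           ≈⟨ ℚP.toℚᵘ-homo-+ (i / n) (j / n) ⟨
  toℚᵘ (i / n + j / n)                     ∎)
  where
  open ℚᵘP.≃-Reasoning
  open +-*-Solver

/-monoˡ-≤ : ∀ {i j} n .{{_ : NonZero n}} → i ℤ.≤ j → i / n ≤ j / n
/-monoˡ-≤ {i} {j} n@(suc _) i≤j = ℚP.toℚᵘ-cancel-≤ (begin
  toℚᵘ (i / n)  ≃⟨ toℚᵘ-/ i n ⟩
  i ℚᵘ./ n      ≤⟨ ℚᵘ.*≤* (ℤP.*-monoʳ-≤-nonNeg (+ n) i≤j) ⟩
  j ℚᵘ./ n      ≃⟨ toℚᵘ-/ j n ⟨
  toℚᵘ (j / n)  ∎)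
  where open ℚᵘP.≤-Reasoning

∣/∣ : ∀ i n .{{_ : NonZero n}} → ∣ i / n ∣ ≡ + ℤ.∣ i ∣ / n
∣/∣ i n@(suc _) = ℚP.toℚᵘ-injective (begin
  toℚᵘ ∣ i / n ∣        ≈⟨ ℚP.toℚᵘ-homo-∣-∣ (i / n) ⟩
  ℚᵘ.∣ toℚᵘ (i / n) ∣   ≈⟨ ℚᵘP.∣-∣-cong (toℚᵘ-/ i n) ⟩
  ℚᵘ.∣ i ℚᵘ./ n ∣       ≈⟨ toℚᵘ-/ (+ ℤ.∣ i ∣) n ⟨
  toℚᵘ (+ ℤ.∣ i ∣ / n)  ∎)
  where open ℚᵘP.≃-Reasoning

n/n≡1 : ∀ n .{{_ : NonZero n}} → + n / n ≡ 1ℚ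
n/n≡1 n@(suc _) = ℚP.toℚᵘ-injective (ℚᵘP.≃-trans (toℚᵘ-/ (+ n) n)
  (ℚᵘ.*≡* (trans (ℤP.*-identityʳ (+ n)) (sym (ℤP.*-identityˡ (+ n))))))

1≤m/n : ∀ {m} n .{{_ : NonZero n}} → n ℕ.≤ m → 1ℚ ≤ + m / n
1≤m/n n n≤m = ℚP.≤-trans (ℚP.≤-reflexive (sym (n/n≡1 n))) (/-monoˡ-≤ n (ℤ.+≤+ n≤m))

n≤∣i∣⇒1≤∣i/n∣ : ∀ i n .{{_ : NonZero n}} → n ℕ.≤ ℤ.∣ i ∣ → 1ℚ ≤ ∣ i / n ∣
n≤∣i∣⇒1≤∣i/n∣ i n n≤∣i∣ = ℚP.≤-trans (1≤m/n n n≤∣i∣) (ℚP.≤-reflexive (sym (∣/∣ i n)))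

∣i∣≤m⇒∣i/n∣≤m/n : ∀ i {m} n .{{_ : NonZero n}} → ℤ.∣ i ∣ ℕ.≤ m → ∣ i / n ∣ ≤ + m / n
∣i∣≤m⇒∣i/n∣≤m/n i n ∣i∣≤m = ℚP.≤-trans (ℚP.≤-reflexive (∣/∣ i n)) (/-monoˡ-≤ n (ℤ.+≤+ ∣i∣≤m))

sumFin-cong : ∀ {A : Set} (_⊕_ : A → A → A) (z : A) m {f g : Fin m → A} →
  (∀ i → f i ≡ g i) → sumFin _⊕_ z m f ≡ sumFin _⊕_ z m g
sumFin-cong _⊕_ z ℕ.zero    f≗g = refl
sumFin-cong _⊕_ z (ℕ.suc m) f≗g = cong₂ _⊕_ (f≗g Fin.zero) (sumFin-cong _⊕_ z m (λ i → f≗g (Fin.suc i)))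

module _ {A B C : Set}
  {_+ᴬ_ : A → A → A} {0ᴬ : A} {_+ᴮ_ : B → B → B} {0ᴮ : B} {_+ᶜ_ : C → C → C} {0ᶜ : C}
  (h : A → B → C) (h-0 : h 0ᴬ 0ᴮ ≡ 0ᶜ)
  (h-+ : ∀ a a′ b b′ → h (a +ᴬ a′) (b +ᴮ b′) ≡ h a b +ᶜ h a′ b′)
  where

  sumFin-zipWith : ∀ m (f : Fin m → A) (g : Fin m → B) →
    sumFin _+ᶜ_ 0ᶜ m (λ i → h (f i) (g i)) ≡ h (sumFin _+ᴬ_ 0ᴬ m f) (sumFin _+ᴮ_ 0ᴮ m g)
  sumFin-zipWith ℕ.zero    f g = sym h-0
  sumFin-zipWith (ℕ.suc m) f g = begin
    h (f Fin.zero) (g Fin.zero) +ᶜ sumFin _+ᶜ_ 0ᶜ m (λ i → h (f (Fin.suc i)) (g (Fin.suc i)))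
      ≡⟨ cong (h (f Fin.zero) (g Fin.zero) +ᶜ_) (sumFin-zipWith m (λ i → f (Fin.suc i)) (λ i → g (Fin.suc i))) ⟩
    h (f Fin.zero) (g Fin.zero) +ᶜ h (sumFin _+ᴬ_ 0ᴬ m (λ i → f (Fin.suc i))) (sumFin _+ᴮ_ 0ᴮ m (λ i → g (Fin.suc i)))
      ≡⟨ h-+ _ _ _ _ ⟨
    h (sumFin _+ᴬ_ 0ᴬ (ℕ.suc m) f) (sumFin _+ᴮ_ 0ᴮ (ℕ.suc m) g)
      ∎
    where open ≡-Reasoning

  if-zipWith : ∀ b x y → (if b then h x y else 0ᶜ) ≡ h (if b then x else 0ᴬ) (if b then y else 0ᴮ)
  if-zipWith true  x y = refl
  if-zipWith false x y = sym h-0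

  sumFin-select-zipWith : ∀ m (b : Fin m → Bool) (f : Fin m → A) (g : Fin m → B) →
    sumFin _+ᶜ_ 0ᶜ m (λ i → if b i then h (f i) (g i) else 0ᶜ)
    ≡ h (sumFin _+ᴬ_ 0ᴬ m (λ i → if b i then f i else 0ᴬ)) (sumFin _+ᴮ_ 0ᴮ m (λ i → if b i then g i else 0ᴮ))
  sumFin-select-zipWith m b f g =
    trans (sumFin-cong _+ᶜ_ 0ᶜ m (λ i → if-zipWith (b i) (f i) (g i))) (sumFin-zipWith m _ _)

  conserves-zipWith : ∀ G o {f g} → Conserves _+ᴬ_ 0ᴬ G o f → Conserves _+ᴮ_ 0ᴮ G o g →
    Conserves _+ᶜ_ 0ᶜ G o (λ e → h (f e) (g e))
  conserves-zipWith G o {f} {g} f-conserves g-conserves v =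
    trans (sumFin-select-zipWith (nE G) _ f g)
      (trans (cong₂ h (f-conserves v) (g-conserves v))
        (sym (sumFin-select-zipWith (nE G) _ f g)))

∣i∣≤1⇒i≡0⊎∣i∣≡1 : ∀ i → ℤ.∣ i ∣ ℕ.≤ 1 → i ≡ + 0 ⊎ ℤ.∣ i ∣ ≡ 1
∣i∣≤1⇒i≡0⊎∣i∣≡1 (+ 0)             _                   = inj₁ refl
∣i∣≤1⇒i≡0⊎∣i∣≡1 (+ 1)             _                   = inj₂ refl
∣i∣≤1⇒i≡0⊎∣i∣≡1 (+ suc (suc _))   (ℕ.s≤s ())
∣i∣≤1⇒i≡0⊎∣i∣≡1 -[1+ 0 ]          _                   = inj₂ refl
∣i∣≤1⇒i≡0⊎∣i∣≡1 -[1+ suc _ ]      (ℕ.s≤s ())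

∣i∣∸∣j∣≤∣i+j∣ : ∀ i j → ℤ.∣ i ∣ ∸ ℤ.∣ j ∣ ℕ.≤ ℤ.∣ i ℤ.+ j ∣
∣i∣∸∣j∣≤∣i+j∣ i j = ℕP.m≤n+o⇒m∸n≤o ℤ.∣ i ∣ ℤ.∣ j ∣ (begin
  ℤ.∣ i ∣                         ≡⟨ cong ℤ.∣_∣ (solve 2 (λ i j → i := (i :+ j) :- j) refl i j) ⟩
  ℤ.∣ (i ℤ.+ j) ℤ.- j ∣           ≤⟨ ℤP.∣i-j∣≤∣i∣+∣j∣ (i ℤ.+ j) j ⟩
  ℤ.∣ i ℤ.+ j ∣ ℕ.+ ℤ.∣ j ∣       ≡⟨ ℕP.+-comm ℤ.∣ i ℤ.+ j ∣ ℤ.∣ j ∣ ⟩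
  ℤ.∣ j ∣ ℕ.+ ℤ.∣ i ℤ.+ j ∣       ∎)
  where
  open ℕP.≤-Reasoning
  open +-*-Solver

merge : ℕ → ℤ → ℤ → ℤ
merge c x y = x ℤ.* + c ℤ.+ y

merge-+ : ∀ c x x′ y y′ → merge c (x ℤ.+ x′) (y ℤ.+ y′) ≡ merge c x y ℤ.+ merge c x′ y′
merge-+ c = solve 5 (λ c x x′ y y′ → (x :+ x′) :* c :+ (y :+ y′) := (x :* c :+ y) :+ (x′ :* c :+ y′)) refl (+ c)
  where open +-*-Solver

record EdgeValues (q s : ℕ) (x y : ℤ) : Set where
  field
    ∣x∣≤1     : ℤ.∣ x ∣ ℕ.≤ 1
    x≡0⇒q≤∣y∣ : x ≡ + 0 → q ℕ.≤ ℤ.∣ y ∣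
    ∣y∣≤s     : ℤ.∣ y ∣ ℕ.≤ s

module _ {q s : ℕ} {x y : ℤ} (xy : EdgeValues q s x y) where
  open EdgeValues xy

  merge-bounds : q ℕ.≤ ℤ.∣ merge (q ℕ.+ s) x y ∣ × ℤ.∣ merge (q ℕ.+ s) x y ∣ ℕ.≤ q ℕ.+ s ℕ.+ s
  merge-bounds with ∣i∣≤1⇒i≡0⊎∣i∣≡1 x ∣x∣≤1
  ... | inj₁ refl = subst (λ z → q ℕ.≤ ℤ.∣ z ∣ × ℤ.∣ z ∣ ℕ.≤ q ℕ.+ s ℕ.+ s) (sym (ℤP.+-identityˡ y))
    (x≡0⇒q≤∣y∣ refl , ℕP.≤-trans ∣y∣≤s (ℕP.m≤n+m s (q ℕ.+ s)))
  ... | inj₂ ∣x∣≡1 = lower , upper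
    where
    open ℕP.≤-Reasoning
    ∣x*[q+s]∣≡q+s : ℤ.∣ x ℤ.* + (q ℕ.+ s) ∣ ≡ q ℕ.+ s
    ∣x*[q+s]∣≡q+s = trans (ℤP.∣i*j∣≡∣i∣*∣j∣ x (+ (q ℕ.+ s)))
      (trans (cong (ℕ._* (q ℕ.+ s)) ∣x∣≡1) (ℕP.*-identityˡ (q ℕ.+ s)))
    lower : q ℕ.≤ ℤ.∣ merge (q ℕ.+ s) x y ∣
    lower = begin
      q                                    ≡⟨ ℕP.m+n∸n≡m q s ⟨
      q ℕ.+ s ∸ s                          ≤⟨ ℕP.∸-monoʳ-≤ (q ℕ.+ s) ∣y∣≤s ⟩
      q ℕ.+ s ∸ ℤ.∣ y ∣                    ≡⟨ cong (_∸ ℤ.∣ y ∣) ∣x*[q+s]∣≡q+s ⟨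
      ℤ.∣ x ℤ.* + (q ℕ.+ s) ∣ ∸ ℤ.∣ y ∣    ≤⟨ ∣i∣∸∣j∣≤∣i+j∣ (x ℤ.* + (q ℕ.+ s)) y ⟩
      ℤ.∣ merge (q ℕ.+ s) x y ∣            ∎
    upper : ℤ.∣ merge (q ℕ.+ s) x y ∣ ℕ.≤ q ℕ.+ s ℕ.+ s
    upper = begin
      ℤ.∣ merge (q ℕ.+ s) x y ∣            ≤⟨ ℤP.∣i+j∣≤∣i∣+∣j∣ (x ℤ.* + (q ℕ.+ s)) y ⟩
      ℤ.∣ x ℤ.* + (q ℕ.+ s) ∣ ℕ.+ ℤ.∣ y ∣  ≡⟨ cong (ℕ._+ ℤ.∣ y ∣) ∣x*[q+s]∣≡q+s ⟩
      q ℕ.+ s ℕ.+ ℤ.∣ y ∣                  ≤⟨ ℕP.+-monoʳ-≤ (q ℕ.+ s) ∣y∣≤s ⟩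
      q ℕ.+ s ℕ.+ s                        ∎

module _ {q s : ℕ} .{{_ : NonZero q}} {x y : ℤ} (xy : EdgeValues q s x y) where
  open EdgeValues xy

  normInf-pair-bounds : q ℕ.≤ s → 1ℚ ≤ normInf (x / 1 , y / q) × normInf (x / 1 , y / q) ≤ + s / q
  normInf-pair-bounds q≤s =
    lower , ℚP.⊔-lub (ℚP.≤-trans (∣i∣≤m⇒∣i/n∣≤m/n x 1 ∣x∣≤1) (1≤m/n q q≤s)) (∣i∣≤m⇒∣i/n∣≤m/n y q ∣y∣≤s)
    where
    lower : 1ℚ ≤ normInf (x / 1 , y / q)
    lower with ∣i∣≤1⇒i≡0⊎∣i∣≡1 x ∣x∣≤1
    ... | inj₁ refl  = ℚP.p≤q⇒p≤r⊔q ∣ + 0 / 1 ∣ (n≤∣i∣⇒1≤∣i/n∣ y q (x≡0⇒q≤∣y∣ refl))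
    ... | inj₂ ∣x∣≡1 = ℚP.p≤q⇒p≤q⊔r ∣ y / q ∣ (n≤∣i∣⇒1≤∣i/n∣ x 1 (ℕP.≤-reflexive (sym ∣x∣≡1)))

  ∣merge/q∣-bounds : 1ℚ ≤ ∣ merge (q ℕ.+ s) x y / q ∣ × ∣ merge (q ℕ.+ s) x y / q ∣ ≤ + (q ℕ.+ s ℕ.+ s) / q
  ∣merge/q∣-bounds = n≤∣i∣⇒1≤∣i/n∣ (merge (q ℕ.+ s) x y) q (proj₁ (merge-bounds xy)) ,
                     ∣i∣≤m⇒∣i/n∣≤m/n (merge (q ℕ.+ s) x y) q (proj₂ (merge-bounds xy))

module _ (p q : ℕ) .{{_ : NonZero q}} where
  open ℚSolver.+-*-Solver

  [p+q]/q≡p/q+1 : + (p ℕ.+ q) / q ≡ + p / q + 1ℚ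
  [p+q]/q≡p/q+1 = trans (/-distribʳ-+ (+ p) (+ q) q) (cong (λ r → + p / q + r) (n/n≡1 q))

  2+t-1≡[p+q]/q : (1ℚ + 1ℚ) + + p / q ℚ.- 1ℚ ≡ + (p ℕ.+ q) / q
  2+t-1≡[p+q]/q = begin
    (1ℚ + 1ℚ) + + p / q ℚ.- 1ℚ  ≡⟨ solve 1 (λ t → (con 1ℚ :+ con 1ℚ) :+ t :- con 1ℚ := t :+ con 1ℚ) refl (+ p / q) ⟩
    + p / q + 1ℚ                ≡⟨ [p+q]/q≡p/q+1 ⟨
    + (p ℕ.+ q) / q             ∎
    where open ≡-Reasoning

  4+2t-1≡[q+2[p+q]]/q : (1ℚ + 1ℚ + 1ℚ + 1ℚ) + (1ℚ + 1ℚ) * (+ p / q) ℚ.- 1ℚ ≡ + (q ℕ.+ (p ℕ.+ q) ℕ.+ (p ℕ.+ q)) / q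
  4+2t-1≡[q+2[p+q]]/q = begin
    (1ℚ + 1ℚ + 1ℚ + 1ℚ) + (1ℚ + 1ℚ) * (+ p / q) ℚ.- 1ℚ
      ≡⟨ solve 1 (λ t → (con 1ℚ :+ con 1ℚ :+ con 1ℚ :+ con 1ℚ) :+ (con 1ℚ :+ con 1ℚ) :* t :- con 1ℚ
                        := con 1ℚ :+ (t :+ con 1ℚ) :+ (t :+ con 1ℚ)) refl (+ p / q) ⟩
    1ℚ + (+ p / q + 1ℚ) + (+ p / q + 1ℚ)
      ≡⟨ cong₂ (λ a b → a + b + b) (n/n≡1 q) [p+q]/q≡p/q+1 ⟨
    + q / q + + (p ℕ.+ q) / q + + (p ℕ.+ q) / q
      ≡⟨ cong (λ r → r + + (p ℕ.+ q) / q) (/-distribʳ-+ (+ q) (+ (p ℕ.+ q)) q) ⟨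
    + (q ℕ.+ (p ℕ.+ q)) / q + + (p ℕ.+ q) / q
      ≡⟨ /-distribʳ-+ (+ (q ℕ.+ (p ℕ.+ q))) (+ (p ℕ.+ q)) q ⟨
    + (q ℕ.+ (p ℕ.+ q) ℕ.+ (p ℕ.+ q)) / q
      ∎
    where open ≡-Reasoning

module FlowPair (p q : ℕ) .{{_ : NonZero q}} (G : Graph) (o : Orientation G) (φ₂ φ : Fin (nE G) → ℤ)
  (φ₂-flow : IsKFlow 2 G o φ₂) (φ-flow : IsKFlow (p ℕ.+ q ℕ.+ 1) G o φ)
  (φ₂≡0⇒q≤∣φ∣ : ∀ e → φ₂ e ≡ + 0 → q ℕ.≤ ℤ.∣ φ e ∣)
  where

  c : ℕ
  c = q ℕ.+ (p ℕ.+ q)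

  edgeValues : ∀ e → EdgeValues q (p ℕ.+ q) (φ₂ e) (φ e)
  edgeValues e = record
    { ∣x∣≤1     = proj₂ φ₂-flow e
    ; x≡0⇒q≤∣y∣ = φ₂≡0⇒q≤∣φ∣ e
    ; ∣y∣≤s     = subst (ℤ.∣ φ e ∣ ℕ.≤_) (ℕP.m+n∸n≡m (p ℕ.+ q) 1) (proj₂ φ-flow e)
    }

  hasChNZF2 : HasChNZF2 ((1ℚ + 1ℚ) + + p / q) G
  hasChNZF2 = o , (λ e → φ₂ e / 1 , φ e / q) ,
    conserves-zipWith (λ x y → x / 1 , y / q) (cong₂ _,_ (ℚP.0/n≡0 1) (ℚP.0/n≡0 q))
      (λ x x′ y y′ → cong₂ _,_ (/-distribʳ-+ x x′ 1) (/-distribʳ-+ y y′ q))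
      G o (proj₁ φ₂-flow) (proj₁ φ-flow) ,
    λ e → map₂ (λ ub → ℚP.≤-trans ub (ℚP.≤-reflexive (sym (2+t-1≡[p+q]/q p q))))
                (normInf-pair-bounds (edgeValues e) (ℕP.m≤n+m q p))

  hasNZF1 : HasNZF1 ((1ℚ + 1ℚ + 1ℚ + 1ℚ) + (1ℚ + 1ℚ) * (+ p / q)) G
  hasNZF1 = o , (λ e → merge c (φ₂ e) (φ e) / q) ,
    conserves-zipWith (λ x y → merge c x y / q) (ℚP.0/n≡0 q)
      (λ x x′ y y′ → trans (cong (_/ q) (merge-+ c x x′ y y′)) (/-distribʳ-+ (merge c x y) (merge c x′ y′) q))
      G o (proj₁ φ₂-flow) (proj₁ φ-flow) ,
    λ e → map₂ (λ ub → ℚP.≤-trans ub (ℚP.≤-reflexive (sym (4+2t-1≡[q+2[p+q]]/q p q))))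
                (∣merge/q∣-bounds (edgeValues e))

proposition22 : (t : ℚ) → 0ℚ < t → t ≤ 1ℚ → (G : Graph) → Bridgeless G → HasFlowPair t G →
    HasChNZF2 ((1ℚ + 1ℚ) + t) G × HasNZF1 ((1ℚ + 1ℚ + 1ℚ + 1ℚ) + (1ℚ + 1ℚ) * t) G
proposition22 t _ _ G _ (p , q , q≢0 , _ , refl , o , φ₂ , φ , φ₂-flow , φ-flow , φ₂≡0⇒q≤∣φ∣) =
  hasChNZF2 , hasNZF1
  where open FlowPair p q {{q≢0}} G o φ₂ φ φ₂-flow φ-flow φ₂≡0⇒q≤∣φ∣
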